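{- Let $k\ge1$, let $e_1,\ldots,e_t$ be positive integers, and let $0\leq r\leq k$. Then \[ R_<\big(M_{e_1}^{k,r},\ldots,M_{e_t}^{k,r}\big)= k\left(1+\sum_{i=1}^t (e_i-1)\right). \]
   Context: An ordered $k$-uniform hypergraph is a $k$-uniform hypergraph with a totally ordered vertex set. An ordered hypergraph $G$ is contained in an ordered hypergraph $H$ if there is an injective order-preserving map $V(G)\to V(H)$ sending every edge of $G$ to an edge of $H$. $K_N^k$ is the complete $k$-uniform hypergraph on $[N]=\{1,\dots,N\}$ with the natural order. For ordered $k$-uniform hypergraphs $G_1,\dots,G_t$, $R_<(G_1,\dots,G_t)$ is the least $N$ such that for every coloring $c:E(K_N^k)\to[t]$ there is a color $j$ such that the hypergraph formed by the edges of color $j$ contains $G_j$. For $0\le r\le k$ and $e\ge1$, the $(k,r)$-nested matching $M_e^{k,r}$ is the ordered $k$-uniform hypergraph on a set of integers (ordered as integers) defined iteratively: $M_1^{k,r}$ has the single edge $A_1=[k]$, and $M_{e+1}^{k,r}$ consists of the edges of $M_e^{k,r}$ together with an edge $A_{e+1}$ consisting of the $r$ least integers greater than $\max V(M_e^{k,r})$ and the $k-r$ greatest integers less than $\min V(M_e^{k,r})$. -}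

module Defs where

open import Data.Nat as ℕ using (ℕ; zero; suc; _∸_; _<ᵇ_)
open import Data.Integer as ℤ using (ℤ; +_)
open import Data.Fin using (Fin; toℕ)
open import Data.Bool using (if_then_else_)
open import Data.Vec using (Vec; lookup; tabulate; map)
open import Data.Vec.Membership.Propositional as VM using ()
open import Data.List using (List; []; _∷_; allFin)
open import Data.Nat.ListAction using (sum)
import Data.List as L
open import Data.List.Relation.Unary.Any using (Any)
open import Data.List.Membership.Propositional as LM using ()
open import Data.Product using (Σ; ∃; _×_; _,_)
open import Relation.Binary.PropositionalEquality using (_≡_)

-- An ordered k-uniform hypergraph whose vertices are integers (ordered as
-- integers).  Each edge is given as the vector of its k vertices listed in
-- strictly increasing order.  The vertex set is the union of the edges
-- (nested matchings have no isolated vertices).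
OrdHyp : ℕ → Set
OrdHyp k = List (Vec ℤ k)

_∈V_ : {k : ℕ} → ℤ → OrdHyp k → Set
x ∈V G = Any (λ A → x VM.∈ A) G

IsEdge : (k N : ℕ) → Vec ℕ k → Set
IsEdge k N v =
  (∀ (i j : Fin k) → toℕ i ℕ.< toℕ j → lookup v i ℕ.< lookup v j) ×
  (∀ (i : Fin k) → 1 ℕ.≤ lookup v i × lookup v i ℕ.≤ N)

Colouring : (k N t : ℕ) → Set
Colouring k N t = (v : Vec ℕ k) → IsEdge k N v → Fin t

Contains : {k N t : ℕ} → Colouring k N t → Fin t → OrdHyp k → Set
Contains {k} {N} c j G =
  Σ (ℤ → ℕ) λ f →
    (∀ x y → x ∈V G → y ∈V G → x ℤ.< y → f x ℕ.< f y) ×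
    (∀ x → x ∈V G → 1 ℕ.≤ f x × f x ℕ.≤ N) ×
    (∀ A → A LM.∈ G → Σ (IsEdge k N (map f A)) λ p → c (map f A) p ≡ j)

RamseyProp : (k t : ℕ) → (Fin t → OrdHyp k) → ℕ → Set
RamseyProp k t G N = (c : Colouring k N t) → ∃ λ j → Contains c j (G j)

RamseyNumberIs : (k t : ℕ) → (Fin t → OrdHyp k) → ℕ → Set
RamseyNumberIs k t G R =
  RamseyProp k t G R × (∀ N → N ℕ.< R → RamseyProp k t G N → Data.Empty.⊥)
  where import Data.Empty

-- Nested matchings.  nest k r n = (edges of M_{n+1}^{k,r}, min V, max V).
record NestData (k : ℕ) : Set where
  constructor nd
  field
    edges : OrdHyp k
    lo    : ℤ
    hi    : ℤ

-- new edge: the k-r greatest integers below lo, then the r least above hi,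
-- listed increasingly
newEdge : (k r : ℕ) → ℤ → ℤ → Vec ℤ k
newEdge k r lo hi = tabulate λ i →
  if toℕ i <ᵇ (k ∸ r)
  then (lo ℤ.- + (k ∸ r)) ℤ.+ + toℕ i
  else (hi ℤ.+ + 1) ℤ.+ + (toℕ i ∸ (k ∸ r))

nest : (k r : ℕ) → ℕ → NestData k
nest k r zero = nd (tabulate (λ i → + suc (toℕ i)) ∷ []) (+ 1) (+ k)
nest k r (suc n) with nest k r n
... | nd es lo hi =
  nd (es L.++ (newEdge k r lo hi ∷ []))
     (lo ℤ.- + (k ∸ r)) (hi ℤ.+ + r)

-- M_e^{k,r} (meaningful for e ≥ 1)
M : (e k r : ℕ) → OrdHyp k
M e k r = NestData.edges (nest k r (e ∸ 1))

sumFin : (t : ℕ) → (Fin t → ℕ) → ℕ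
sumFin t f = sum (L.map f (allFin t))

module Submission where

-- Upper bound (module Upper): M_{S+1} placed on [1, k(1+S)] has S + 1 edges
-- ("slots"); by the pigeonhole principle for sequences some colour i occurs on
-- h_i + 1 slots s_0 < … < s_{h_i}, and since relabelling edges monotonically
-- preserves Before, these slots form a copy of M_{e_i} of colour i.
-- Lower bound (module Lower): for N < k(1+S) colour an edge by the block of
-- [1, kS] (blocks of lengths k·h_i) containing its gap, the distance between its
-- a-th and (a+1)-th vertex, using sentinels 0 and N+1 (module Gap).  In a copy of
-- M_{n+1} each edge encloses the previous one, so gaps grow by k per edge, and
-- n + 1 gaps cannot fit in one block of length k·n.

open import Defs
open import Data.Nat using (ℕ; _≤_; _*_; _+_; _∸_)
open import Data.Fin using (Fin)

open import Function using (_∘_; id)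
open import Data.Nat as N using (zero; suc; _<_; z≤n; s≤s; z<s; _<ᵇ_; _⊓_; pred)
import Data.Nat.Properties as NP
import Data.Nat.Tactic.RingSolver as NatSolver
open import Data.Integer as Z using (ℤ; +_)
import Data.Integer.Properties as ZP
import Data.Integer.Tactic.RingSolver as IntSolver
open import Data.Fin using (toℕ; fromℕ<) renaming (zero to fzero; suc to fsuc)
import Data.Fin.Properties as FP
open import Data.Vec as V using (Vec; []; _∷_; lookup; tabulate)
import Data.Vec.Properties as VP
open import Data.Vec.Functional using (updateAt)
open import Data.Vec.Functional.Properties using (updateAt-updates; updateAt-minimal)
open import Data.List as L using (List; upTo; cartesianProduct)
import Data.List.Properties as LP
open import Data.Nat.ListAction using (sum)
import Data.List.Relation.Unary.Any as LA
import Data.Vec.Relation.Unary.Any as VA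
import Data.Vec.Relation.Unary.Any.Properties as VAP
open import Data.List.Membership.Propositional as LM using ()
open import Data.Vec.Membership.Propositional as VM using ()
import Data.List.Membership.Propositional.Properties as LMP
import Data.Vec.Membership.Propositional.Properties as VMP
open import Data.Bool using (true; false; if_then_else_; T)
open import Data.Unit using (tt)
open import Data.Empty using (⊥; ⊥-elim)
open import Data.Product using (Σ; _×_; _,_; proj₁; proj₂; uncurry)
open import Data.Sum using (_⊎_; inj₁; inj₂; swap)
open import Relation.Nullary using (yes; no)
open import Relation.Binary.Definitions using (DecidableEquality; tri<; tri≈; tri>)
open import Relation.Binary.PropositionalEquality

if-< : ∀ {A : Set} {i n} {x y : A} → i < n → (if i <ᵇ n then x else y) ≡ x
if-< {i = i} {n} i<n with i <ᵇ n | NP.<⇒<ᵇ i<n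
... | true  | _ = refl

if-≥ : ∀ {A : Set} {i n} {x y : A} → n ≤ i → (if i <ᵇ n then x else y) ≡ y
if-≥ {i = i} {n} n≤i with i <ᵇ n in eq
... | false = refl
... | true  = ⊥-elim (NP.≤⇒≯ n≤i (NP.<ᵇ⇒< i n (subst T (sym eq) tt)))

ℤ-lo-step : ∀ (x y : ℤ) → (+ 1 Z.- y) Z.- x ≡ + 1 Z.- (x Z.+ y)
ℤ-lo-step = IntSolver.solve-∀

ℤ-left-vertex : ∀ (i x y : ℤ) → ((+ 1 Z.- y) Z.- x) Z.+ i ≡ (+ 1 Z.+ i) Z.- (x Z.+ y)
ℤ-left-vertex = IntSolver.solve-∀

ℕ-right-vertex : ∀ (a r d y : ℕ) → (a + r + y + 1) + d ≡ suc (a + d) + (r + y)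
ℕ-right-vertex = NatSolver.solve-∀

ℤ-cancel : ∀ (x y z : ℤ) → (x Z.- y) Z.+ (y Z.+ z) ≡ x Z.+ z
ℤ-cancel = IntSolver.solve-∀

+-right-swap : ∀ (x y z : ℕ) → x + y + z ≡ x + z + y
+-right-swap = NatSolver.solve-∀

+-assoc-swap : ∀ (x y z : ℕ) → x + (y + z) ≡ x + z + y
+-assoc-swap = NatSolver.solve-∀

ℤ-unshift : ∀ (x c : ℤ) → (x Z.+ c) Z.- c ≡ x
ℤ-unshift = IntSolver.solve-∀

+-regroup : ∀ x a r p → x + (a + r) + p ≡ x + (p + a) + r
+-regroup = NatSolver.solve-∀

sumFin-suc : ∀ t (w : Fin (suc t) → ℕ) → sumFin (suc t) w ≡ w fzero + sumFin t (w ∘ fsuc)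
sumFin-suc t w = cong (_+_ (w fzero)) (cong sum
  (trans (LP.map-tabulate fsuc w) (sym (LP.map-tabulate id (w ∘ fsuc)))))

sumFin-*ˡ : ∀ t c (w : Fin t → ℕ) → sumFin t (λ i → c * w i) ≡ c * sumFin t w
sumFin-*ˡ zero    c w = sym (NP.*-zeroʳ c)
sumFin-*ˡ (suc t) c w = begin
  sumFin (suc t) (λ i → c * w i)          ≡⟨ sumFin-suc t _ ⟩
  c * w fzero + sumFin t (λ i → c * w (fsuc i))
                                          ≡⟨ cong (_+_ (c * w fzero)) (sumFin-*ˡ t c (w ∘ fsuc)) ⟩
  c * w fzero + c * sumFin t (w ∘ fsuc) ≡⟨ sym (NP.*-distribˡ-+ c _ _) ⟩
  c * (w fzero + sumFin t (w ∘ fsuc))   ≡⟨ cong (c *_) (sym (sumFin-suc t w)) ⟩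
  c * sumFin (suc t) w                    ∎
  where open ≡-Reasoning

sumFin-lower : ∀ t (w : Fin t → ℕ) c → 1 ≤ w c → suc (sumFin t (updateAt w c pred)) ≡ sumFin t w
sumFin-lower (suc t) w fzero 1≤wc = begin
  suc (sumFin (suc t) (updateAt w fzero pred))
    ≡⟨ cong suc (sumFin-suc t _) ⟩
  suc (pred (w fzero) + sumFin t (w ∘ fsuc))
    ≡⟨ cong (_+ sumFin t (w ∘ fsuc)) (NP.suc-pred (w fzero) {{N.>-nonZero 1≤wc}}) ⟩
  w fzero + sumFin t (w ∘ fsuc)  ≡⟨ sym (sumFin-suc t w) ⟩
  sumFin (suc t) w                 ∎
  where open ≡-Reasoning
sumFin-lower (suc t) w (fsuc c) 1≤wc = begin
  suc (sumFin (suc t) (updateAt w (fsuc c) pred))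
    ≡⟨ cong suc (sumFin-suc t _) ⟩
  suc (w fzero + sumFin t (updateAt (w ∘ fsuc) c pred))
    ≡⟨ sym (NP.+-suc (w fzero) _) ⟩
  w fzero + suc (sumFin t (updateAt (w ∘ fsuc) c pred))
    ≡⟨ cong (_+_ (w fzero)) (sumFin-lower t (w ∘ fsuc) c 1≤wc) ⟩
  w fzero + sumFin t (w ∘ fsuc)  ≡⟨ sym (sumFin-suc t w) ⟩
  sumFin (suc t) w                 ∎
  where open ≡-Reasoning

-- Cutting ℕ⁺ into consecutive blocks of lengths w 0, w 1, …: block i is the
-- interval (offset w i, offset w i + w i].
offset : ∀ {t} → (Fin t → ℕ) → Fin t → ℕ
offset w fzero    = 0
offset w (fsuc i) = w fzero + offset (w ∘ fsuc) i

-- The block containing position g (the last block when g lies beyond all blocks).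
blockOf : ∀ t → (Fin (suc t) → ℕ) → ℕ → Fin (suc t)
blockOf zero    w g = fzero
blockOf (suc t) w g with g N.≤? w fzero
... | yes _ = fzero
... | no  _ = fsuc (blockOf t (w ∘ fsuc) (g ∸ w fzero))

blockOf-lower : ∀ t w g → 1 ≤ g → offset w (blockOf t w g) < g
blockOf-lower zero    w g 1≤g = 1≤g
blockOf-lower (suc t) w g 1≤g with g N.≤? w fzero
... | yes _ = 1≤g
... | no  g≰w0 = subst (w fzero + offset (w ∘ fsuc) (blockOf t (w ∘ fsuc) (g ∸ w fzero)) <_)
                   (NP.m+[n∸m]≡n (NP.<⇒≤ w0<g))
                   (NP.+-monoʳ-< (w fzero) (blockOf-lower t (w ∘ fsuc) (g ∸ w fzero) (NP.m<n⇒0<n∸m w0<g)))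
  where w0<g = NP.≰⇒> g≰w0

blockOf-upper : ∀ t w g → g ≤ sumFin (suc t) w → g ≤ offset w (blockOf t w g) + w (blockOf t w g)
blockOf-upper zero    w g g≤Σ = subst (g ≤_) (NP.+-identityʳ (w fzero)) g≤Σ
blockOf-upper (suc t) w g g≤Σ with g N.≤? w fzero
... | yes g≤w0 = g≤w0
... | no  _    = begin
  g                                       ≤⟨ NP.m≤n+m∸n g (w fzero) ⟩
  w fzero + (g ∸ w fzero)                 ≤⟨ NP.+-monoʳ-≤ (w fzero) (blockOf-upper t (w ∘ fsuc) (g ∸ w fzero) rest) ⟩
  w fzero + (offset (w ∘ fsuc) b + w (fsuc b)) ≡⟨ sym (NP.+-assoc (w fzero) _ _) ⟩
  w fzero + offset (w ∘ fsuc) b + w (fsuc b) ∎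
  where
  open NP.≤-Reasoning
  b = blockOf t (w ∘ fsuc) (g ∸ w fzero)
  rest : g ∸ w fzero ≤ sumFin (suc t) (w ∘ fsuc)
  rest = NP.m≤n+o⇒m∸n≤o g (w fzero) (subst (g ≤_) (sumFin-suc (suc t) w) g≤Σ)

record Class {t} (col : ℕ → Fin t) (d : Fin t → ℕ) (lo len : ℕ) : Set where
  field
    colour      : Fin t
    pick        : ℕ → ℕ
    pick-range  : ∀ l → l ≤ d colour → lo ≤ pick l × pick l < lo + len
    pick-step   : ∀ l → l < d colour → pick l < pick (suc l)
    pick-colour : ∀ l → l ≤ d colour → col (pick l) ≡ colour

Class-widen : ∀ {t} {col : ℕ → Fin t} {d d′ lo len} (C : Class col d′ (suc lo) len) →
              d (Class.colour C) ≡ d′ (Class.colour C) → Class col d lo (suc len)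
Class-widen {d = d} {d′} {lo} {len} C eq = record
  { colour      = colour
  ; pick        = pick
  ; pick-range  = λ l l≤ → let (lo< , <hi) = pick-range l (subst (l ≤_) eq l≤)
                            in NP.<⇒≤ lo< , subst (pick l <_) (sym (NP.+-suc lo len)) <hi
  ; pick-step   = λ l l< → pick-step l (subst (l <_) eq l<)
  ; pick-colour = λ l l≤ → pick-colour l (subst (l ≤_) eq l≤)
  }
  where open Class C

Class-cons : ∀ {t} {col : ℕ → Fin t} {d lo len} (C : Class col (updateAt d (col lo) pred) (suc lo) len) →
             Class.colour C ≡ col lo → Class col d lo (suc len)
Class-cons {col = col} {d} {lo} {len} C refl = record
  { colour      = colour
  ; pick        = pick′
  ; pick-range  = range′
  ; pick-step   = step′
  ; pick-colour = colour′
  }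
  where
  open Class C
  lowered : ∀ {l} → suc l ≤ d colour → l ≤ updateAt d colour pred colour
  lowered {l} sl≤ = subst (l ≤_) (sym (updateAt-updates colour d)) (NP.<⇒≤pred sl≤)
  pick′ : ℕ → ℕ
  pick′ zero    = lo
  pick′ (suc l) = pick l
  range′ : ∀ l → l ≤ d colour → lo ≤ pick′ l × pick′ l < lo + suc len
  range′ zero    _  = NP.≤-refl , NP.m<m+n lo z<s
  range′ (suc l) sl≤ = let (lo< , <hi) = pick-range l (lowered sl≤)
                       in NP.<⇒≤ lo< , subst (pick l <_) (sym (NP.+-suc lo len)) <hi
  step′ : ∀ l → l < d colour → pick′ l < pick′ (suc l)
  step′ zero    _   = proj₁ (pick-range 0 z≤n)
  step′ (suc l) sl< = pick-step l (NP.<-≤-trans (NP.n<1+n l) (lowered sl<))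
  colour′ : ∀ l → l ≤ d colour → col (pick′ l) ≡ colour
  colour′ zero    _   = refl
  colour′ (suc l) sl≤ = pick-colour l (lowered sl≤)

-- Induction on the window: if the demand at the colour of its first point lo is 0,
-- lo alone is a class; otherwise take a class of the rest for the demand lowered there.
pigeonhole : ∀ {t} (col : ℕ → Fin t) (d : Fin t → ℕ) lo len → sumFin t d < len → Class col d lo len
pigeonhole col d lo zero    ()
pigeonhole col d lo (suc len) Σd<len with d (col lo) in eq
... | zero  = record
  { colour      = col lo
  ; pick        = λ _ → lo
  ; pick-range  = λ _ _ → NP.≤-refl , NP.m<m+n lo z<s
  ; pick-step   = λ l l< → ⊥-elim (NP.n≮0 (subst (l <_) eq l<))
  ; pick-colour = λ _ _ → refl
  }
... | suc _ = extend (pigeonhole col (updateAt d (col lo) pred) (suc lo) len Σd′<len)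
  where
  Σd′<len : sumFin _ (updateAt d (col lo) pred) < len
  Σd′<len = NP.≤-pred (subst (_< suc len) (sym (sumFin-lower _ d (col lo) (subst (1 ≤_) (sym eq) (s≤s z≤n)))) Σd<len)

  extend : Class col (updateAt d (col lo) pred) (suc lo) len → Class col d lo (suc len)
  extend C with Class.colour C FP.≟ col lo
  ... | yes same = Class-cons C same
  ... | no  diff = Class-widen C (sym (updateAt-minimal (Class.colour C) (col lo) d diff))

spread : (g : ℕ → ℕ) (m : ℕ) → (∀ i → i < m → g i < g (suc i)) →
         ∀ i d → i + d ≤ m → g i + d ≤ g (i + d)
spread g m step i zero    _ = NP.≤-reflexive (trans (NP.+-identityʳ (g i)) (cong g (sym (NP.+-identityʳ i))))
spread g m step i (suc d) i+sd≤m = begin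
  g i + suc d       ≡⟨ NP.+-suc (g i) d ⟩
  suc (g i + d)     ≤⟨ s≤s (spread g m step i d (NP.<⇒≤ i+d<m)) ⟩
  suc (g (i + d))   ≤⟨ step (i + d) i+d<m ⟩
  g (suc (i + d))   ≡⟨ cong g (sym (NP.+-suc i d)) ⟩
  g (i + suc d)     ∎
  where
  open NP.≤-Reasoning
  i+d<m : i + d < m
  i+d<m = subst (_≤ m) (NP.+-suc i d) i+sd≤m

step-mono : (g : ℕ → ℕ) (m : ℕ) → (∀ i → i < m → g i < g (suc i)) →
            ∀ {x y} → x < y → y ≤ m → g x < g y
step-mono g m step {x} {y} x<y y≤m = begin-strict
  g x               <⟨ NP.m<m+n (g x) (NP.m<n⇒0<n∸m x<y) ⟩
  g x + (y ∸ x)     ≤⟨ spread g m step x (y ∸ x) (subst (_≤ m) (sym x+[y∸x]≡y) y≤m) ⟩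
  g (x + (y ∸ x))   ≡⟨ cong g x+[y∸x]≡y ⟩
  g y               ∎
  where
  open NP.≤-Reasoning
  x+[y∸x]≡y = NP.m+[n∸m]≡n (NP.<⇒≤ x<y)

module _ {X A B : Set} (_≟_ : DecidableEquality A) (key : X → A) (val : X → B) (default : B) where

  tableOn : List X → A → B
  tableOn L.[]       y = default
  tableOn (x L.∷ xs) y with key x ≟ y
  ... | yes _ = val x
  ... | no  _ = tableOn xs y

  tableOn-key : ∀ xs {x} → x LM.∈ xs → (∀ {x′} → x′ LM.∈ xs → key x′ ≡ key x → val x′ ≡ val x) →
                tableOn xs (key x) ≡ val x
  tableOn-key (x′ L.∷ xs) {x} x∈ functional with key x′ ≟ key x
  ... | yes same = functional (LA.here refl) same
  ... | no  diff with x∈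
  ...   | LA.here refl = ⊥-elim (diff refl)
  ...   | LA.there x∈xs = tableOn-key xs x∈xs (functional ∘ LA.there)

entry : ∀ {k} → ℕ → Vec ℕ k → ℕ → ℕ
entry d []      i       = d
entry d (x ∷ v) zero    = x
entry d (x ∷ v) (suc i) = entry d v i

entry-lookup : ∀ {k} d (v : Vec ℕ k) (i : Fin k) → entry d v (toℕ i) ≡ lookup v i
entry-lookup d (x ∷ v) fzero    = refl
entry-lookup d (x ∷ v) (fsuc i) = entry-lookup d v i

entry-< : ∀ {k} d (v : Vec ℕ k) {i} (i<k : i < k) → entry d v i ≡ lookup v (fromℕ< i<k)
entry-< d v i<k = trans (cong (entry d v) (sym (FP.toℕ-fromℕ< i<k))) (entry-lookup d v (fromℕ< i<k))

entry-beyond : ∀ {k} d (v : Vec ℕ k) {i} → k ≤ i → entry d v i ≡ d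
entry-beyond d []      _         = refl
entry-beyond d (x ∷ v) (s≤s k≤i) = entry-beyond d v k≤i

framed : ∀ {k} → ℕ → Vec ℕ k → ℕ → ℕ
framed N v zero    = 0
framed N v (suc i) = entry (suc N) v i

framed-step : ∀ {k N} {v : Vec ℕ k} → IsEdge k N v → ∀ i → i < suc k → framed N v i < framed N v (suc i)
framed-step {v = []}    E zero _ = z<s
framed-step {v = x ∷ v} E zero _ = proj₁ (proj₂ E fzero)
framed-step {k} {N} {v} E (suc i) (s≤s i<k) with suc i N.<? k
... | yes si<k = subst₂ _<_ (sym (entry-< (suc N) v i<k)) (sym (entry-< (suc N) v si<k))
                   (proj₁ E (fromℕ< i<k) (fromℕ< si<k)
                     (subst₂ _<_ (sym (FP.toℕ-fromℕ< i<k)) (sym (FP.toℕ-fromℕ< si<k)) (NP.n<1+n i)))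
... | no  si≮k = subst₂ _<_ (sym (entry-< (suc N) v i<k)) (sym (entry-beyond (suc N) v (NP.≮⇒≥ si≮k)))
                   (s≤s (proj₂ (proj₂ E (fromℕ< i<k))))

framed-spread : ∀ {k N} {v : Vec ℕ k} → IsEdge k N v → ∀ i d → i + d ≤ suc k →
                framed N v i + d ≤ framed N v (i + d)
framed-spread {k} {N} {v} E = spread (framed N v) (suc k) (framed-step E)

edge-size : ∀ {k N} {v : Vec ℕ k} → IsEdge k N v → k ≤ N
edge-size {k} {N} {v} E = NP.≤-pred (subst (suc k ≤_) (entry-beyond (suc N) v NP.≤-refl)
                                        (framed-spread {v = v} E 0 (suc k) NP.≤-refl))

Encloses : ∀ {k} → ℕ → Vec ℕ k → Vec ℕ k → Set
Encloses {k} a u′ u = ∀ (i j : Fin k) →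
  (toℕ i < a → lookup u′ i < lookup u j) × (a ≤ toℕ i → lookup u j < lookup u′ i)

enclose-left : ∀ {k N a} {u′ u : Vec ℕ k} → IsEdge k N u → a ≤ k → Encloses a u′ u →
               framed N u′ a + a ≤ framed N u a
enclose-left {a = zero}  _ _ _ = z≤n
enclose-left {k} {N} {suc a} {u′} {u} E a<k enc = begin
  framed N u′ (suc a) + suc a   ≡⟨ NP.+-suc _ a ⟩
  suc (framed N u′ (suc a)) + a ≤⟨ NP.+-monoˡ-≤ a u′ₐ<u₀ ⟩
  framed N u 1 + a              ≤⟨ framed-spread {v = u} E 1 a (s≤s (NP.<⇒≤ a<k)) ⟩
  framed N u (suc a)            ∎
  where
  open NP.≤-Reasoning
  0<k = NP.<-≤-trans z<s a<k
  u′ₐ<u₀ : framed N u′ (suc a) < framed N u 1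
  u′ₐ<u₀ = subst₂ _<_ (sym (entry-< (suc N) u′ a<k)) (sym (entry-< (suc N) u 0<k))
             (proj₁ (enc (fromℕ< a<k) (fromℕ< 0<k)) (subst (_< suc a) (sym (FP.toℕ-fromℕ< a<k)) (NP.n<1+n a)))

enclose-right : ∀ {k N a r} {u′ u : Vec ℕ k} → IsEdge k N u → a + r ≡ k → Encloses a u′ u →
                framed N u (suc a) + r ≤ framed N u′ (suc a)
enclose-right {k} {N} {a} {zero} {u′} {u} _ a+0≡k _ =
  NP.≤-reflexive (trans (NP.+-identityʳ _) (trans (entry-beyond (suc N) u k≤a) (sym (entry-beyond (suc N) u′ k≤a))))
  where k≤a = NP.≤-reflexive (trans (sym a+0≡k) (NP.+-identityʳ a))
enclose-right {k} {N} {a} {suc r} {u′} {u} E a+sr≡k enc = begin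
  framed N u (suc a) + suc r     ≡⟨ NP.+-suc _ r ⟩
  suc (framed N u (suc a) + r)   ≤⟨ s≤s (framed-spread {v = u} E (suc a) r (NP.≤-trans (NP.≤-reflexive a+sr) (NP.n≤1+n k))) ⟩
  suc (framed N u (suc a + r))   ≤⟨ uₖ<u′ₐ ⟩
  framed N u′ (suc a)            ∎
  where
  open NP.≤-Reasoning
  a+sr : suc a + r ≡ k
  a+sr = trans (sym (NP.+-suc a r)) a+sr≡k
  a+r<k : a + r < k
  a+r<k = NP.≤-reflexive a+sr
  a<k : a < k
  a<k = NP.≤-<-trans (NP.m≤m+n a r) a+r<k
  uₖ<u′ₐ : framed N u (suc a + r) < framed N u′ (suc a)
  uₖ<u′ₐ = subst₂ _<_ (sym (entry-< (suc N) u a+r<k)) (sym (entry-< (suc N) u′ a<k))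
                 (proj₂ (enc (fromℕ< a<k) (fromℕ< a+r<k)) (NP.≤-reflexive (sym (FP.toℕ-fromℕ< a<k))))

module Gap (k N a r : ℕ) (a+r≡k : a + r ≡ k) where

  gap : Vec ℕ k → ℕ
  gap v = framed N v (suc a) ∸ framed N v a

  private
    a≤k : a ≤ k
    a≤k = subst (a ≤_) a+r≡k (NP.m≤m+n a r)

    gap+prev : ∀ {v} → IsEdge k N v → gap v + framed N v a ≡ framed N v (suc a)
    gap+prev E = NP.m∸n+n≡m (NP.<⇒≤ (framed-step E a (s≤s a≤k)))

  gap-positive : ∀ {v} → IsEdge k N v → 1 ≤ gap v
  gap-positive E = NP.m<n⇒0<n∸m (framed-step E a (s≤s a≤k))

  -- A gap leaves room for the a left and r right vertices inside [1, N].
  gap-bound : ∀ {v} → IsEdge k N v → gap v + k ≤ suc N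
  gap-bound {v} E = begin
    gap v + k                  ≡⟨ cong (_+_ (gap v)) (sym a+r≡k) ⟩
    gap v + (a + r)            ≡⟨ sym (NP.+-assoc (gap v) a r) ⟩
    gap v + a + r              ≤⟨ NP.+-monoˡ-≤ r (NP.+-monoʳ-≤ (gap v) (framed-spread {v = v} E 0 a (NP.m≤n⇒m≤1+n a≤k))) ⟩
    gap v + framed N v a + r   ≡⟨ cong (_+ r) (gap+prev E) ⟩
    framed N v (suc a) + r     ≤⟨ framed-spread {v = v} E (suc a) r (s≤s (NP.≤-reflexive a+r≡k)) ⟩
    framed N v (suc a + r)     ≡⟨ entry-beyond (suc N) v (NP.≤-reflexive (sym a+r≡k)) ⟩
    suc N                      ∎
    where open NP.≤-Reasoning

  gap-nested : ∀ {u′ u} → IsEdge k N u → Encloses a u′ u → gap u + k ≤ gap u′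
  gap-nested {u′} {u} E enc = NP.m+n≤o⇒m≤o∸n (gap u + k) (begin
    gap u + k + framed N u′ a          ≡⟨ cong (λ z → gap u + z + framed N u′ a) (sym a+r≡k) ⟩
    gap u + (a + r) + framed N u′ a    ≡⟨ +-regroup (gap u) a r (framed N u′ a) ⟩
    gap u + (framed N u′ a + a) + r    ≤⟨ NP.+-monoˡ-≤ r (NP.+-monoʳ-≤ (gap u) (enclose-left {u′ = u′} {u} E a≤k enc)) ⟩
    gap u + framed N u a + r           ≡⟨ cong (_+ r) (gap+prev E) ⟩
    framed N u (suc a) + r             ≤⟨ enclose-right {u′ = u′} {u} E a+r≡k enc ⟩
    framed N u′ (suc a)                ∎)
    where open NP.≤-Reasoning

module Nested (k r : ℕ) (r≤k : r ≤ k) where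

  a : ℕ
  a = k ∸ r

  a+r≡k : a + r ≡ k
  a+r≡k = NP.m∸n+n≡m r≤k

  -- The i-th vertex (0 ≤ i < k) of the j-th edge.
  vertex : ℕ → ℕ → ℤ
  vertex j i = if i <ᵇ a then + suc i Z.- + (j * a) else + (suc i + j * r)

  vertex-left : ∀ j {i} → i < a → vertex j i ≡ + suc i Z.- + (j * a)
  vertex-left j = if-<

  vertex-right : ∀ j {i} → a ≤ i → vertex j i ≡ + (suc i + j * r)
  vertex-right j = if-≥

  edge : ℕ → Vec ℤ k
  edge j = tabulate (vertex j ∘ toℕ)

  lookup-edge : ∀ j (i : Fin k) → lookup (edge j) i ≡ vertex j (toℕ i)
  lookup-edge j = VP.lookup∘tabulate (vertex j ∘ toℕ)

  edgesUpTo : ℕ → OrdHyp k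
  edgesUpTo zero    = edge 0 L.∷ L.[]
  edgesUpTo (suc n) = edgesUpTo n L.++ (edge (suc n) L.∷ L.[])

  first-edge : tabulate (λ (i : Fin k) → + suc (toℕ i)) ≡ edge 0
  first-edge = VP.tabulate-cong (λ i → at (toℕ i))
    where
    at : ∀ i → + suc i ≡ vertex 0 i
    at i with i N.<? a
    ... | yes i<a = sym (trans (vertex-left 0 i<a) (cong +_ (NP.+-identityʳ (suc i))))
    ... | no  i≮a = sym (trans (vertex-right 0 (NP.≮⇒≥ i≮a)) (cong +_ (NP.+-identityʳ (suc i))))

  next-edge : ∀ n → newEdge k r (+ 1 Z.- + (n * a)) (+ (k + n * r)) ≡ edge (suc n)
  next-edge n = VP.tabulate-cong (λ i → at (toℕ i))
    where
    at : ∀ i → (if i <ᵇ a then ((+ 1 Z.- + (n * a)) Z.- + a) Z.+ + i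
                          else (+ (k + n * r) Z.+ + 1) Z.+ + (i ∸ a)) ≡ vertex (suc n) i
    at i with i N.<? a
    ... | yes i<a = begin
      (if i <ᵇ a then _ else _)                 ≡⟨ if-< i<a ⟩
      ((+ 1 Z.- + (n * a)) Z.- + a) Z.+ + i     ≡⟨ ℤ-left-vertex (+ i) (+ a) (+ (n * a)) ⟩
      + suc i Z.- + (suc n * a)                 ≡⟨ sym (vertex-left (suc n) i<a) ⟩
      vertex (suc n) i                          ∎
      where open ≡-Reasoning
    ... | no  i≮a = begin
      (if i <ᵇ a then _ else _)                 ≡⟨ if-≥ a≤i ⟩
      + (k + n * r + 1 + (i ∸ a))               ≡⟨ cong (λ z → + (z + n * r + 1 + (i ∸ a))) (sym a+r≡k) ⟩
      + (a + r + n * r + 1 + (i ∸ a))           ≡⟨ cong +_ (ℕ-right-vertex a r (i ∸ a) (n * r)) ⟩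
      + (suc (a + (i ∸ a)) + suc n * r)         ≡⟨ cong (λ z → + (suc z + suc n * r)) (NP.m+[n∸m]≡n a≤i) ⟩
      + (suc i + suc n * r)                     ≡⟨ sym (vertex-right (suc n) a≤i) ⟩
      vertex (suc n) i                          ∎
      where
      open ≡-Reasoning
      a≤i = NP.≮⇒≥ i≮a

  nest-explicit : ∀ n → nest k r n ≡ nd (edgesUpTo n) (+ 1 Z.- + (n * a)) (+ (k + n * r))
  nest-explicit zero = cong₂ (λ v h → nd (v L.∷ L.[]) (+ 1) h) first-edge (cong +_ (sym (NP.+-identityʳ k)))
  nest-explicit (suc n) rewrite nest-explicit n =
    trans (cong (λ v → nd (edgesUpTo n L.++ (v L.∷ L.[])) (lo Z.- + a) (hi Z.+ + r)) (next-edge n))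
          (cong₂ (nd _) (ℤ-lo-step (+ a) (+ (n * a)))
                        (cong +_ (trans (NP.+-assoc k (n * r) r) (cong (_+_ k) (NP.+-comm (n * r) r)))))
    where
    lo = + 1 Z.- + (n * a)
    hi = + (k + n * r)

  M-explicit : ∀ e → M e k r ≡ edgesUpTo (e ∸ 1)
  M-explicit e = cong NestData.edges (nest-explicit (e ∸ 1))

  -- Position of vertex (j, i) when M_{n+1} is placed on [1, k(n+1)]: a translate of vertex.
  place : ℕ → ℕ → ℕ → ℕ
  place n j i = if i <ᵇ a then suc i + (n ∸ j) * a else suc i + n * a + j * r

  place-left : ∀ n j {i} → i < a → place n j i ≡ suc i + (n ∸ j) * a
  place-left n j = if-<

  place-right : ∀ n j {i} → a ≤ i → place n j i ≡ suc i + n * a + j * r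
  place-right n j = if-≥

  place-shift : ∀ n j i → j ≤ n → vertex j i Z.+ + (n * a) ≡ + place n j i
  place-shift n j i j≤n with i N.<? a
  ... | yes i<a = begin
    vertex j i Z.+ + (n * a)                          ≡⟨ cong (Z._+ + (n * a)) (vertex-left j i<a) ⟩
    (+ suc i Z.- + (j * a)) Z.+ + (n * a)             ≡⟨ cong (λ m → (+ suc i Z.- + (j * a)) Z.+ + (m * a)) (sym (NP.m+[n∸m]≡n j≤n)) ⟩
    (+ suc i Z.- + (j * a)) Z.+ + ((j + (n ∸ j)) * a) ≡⟨ cong (λ m → (+ suc i Z.- + (j * a)) Z.+ + m) (NP.*-distribʳ-+ a j (n ∸ j)) ⟩
    (+ suc i Z.- + (j * a)) Z.+ (+ (j * a) Z.+ + ((n ∸ j) * a)) ≡⟨ ℤ-cancel (+ suc i) (+ (j * a)) (+ ((n ∸ j) * a)) ⟩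
    + (suc i + (n ∸ j) * a)                           ≡⟨ cong +_ (sym (place-left n j i<a)) ⟩
    + place n j i                                     ∎
    where open ≡-Reasoning
  ... | no  i≮a = begin
    vertex j i Z.+ + (n * a)      ≡⟨ cong (Z._+ + (n * a)) (vertex-right j a≤i) ⟩
    + (suc i + j * r + n * a)     ≡⟨ cong +_ (+-right-swap (suc i) (j * r) (n * a)) ⟩
    + (suc i + n * a + j * r)     ≡⟨ cong +_ (sym (place-right n j a≤i)) ⟩
    + place n j i                 ∎
    where
    open ≡-Reasoning
    a≤i = NP.≮⇒≥ i≮a

  data Before : ℕ → ℕ → ℕ → ℕ → Set where
    inner       : ∀ {j i i′} → i < i′ → Before j i j i′
    outer-left  : ∀ {j i j′ i′} → i < a → i′ < a → j′ < j → Before j i j′ i′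
    across      : ∀ {j i j′ i′} → i < a → a ≤ i′ → Before j i j′ i′
    outer-right : ∀ {j i j′ i′} → a ≤ i → a ≤ i′ → j < j′ → Before j i j′ i′

  place-across : ∀ M j j′ {i i′} → i < a → a ≤ i′ → place M j i < place M j′ i′
  place-across M j j′ {i} {i′} i<a a≤i′ = begin-strict
    place M j i                   ≡⟨ place-left M j i<a ⟩
    suc i + (M ∸ j) * a           ≤⟨ NP.+-mono-≤ i<a (NP.*-monoˡ-≤ a (NP.m∸n≤m M j)) ⟩
    a + M * a                     ≤⟨ NP.+-monoˡ-≤ (M * a) a≤i′ ⟩
    i′ + M * a                    <⟨ NP.n<1+n _ ⟩
    suc i′ + M * a                ≤⟨ NP.m≤m+n _ _ ⟩
    suc i′ + M * a + j′ * r       ≡⟨ sym (place-right M j′ a≤i′) ⟩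
    place M j′ i′                 ∎
    where open NP.≤-Reasoning

  before⇒place< : ∀ M {j i j′ i′} → j ≤ M → i < k → Before j i j′ i′ → place M j i < place M j′ i′
  before⇒place< M {j} {i} {_} {i′} _ _ (inner i<i′) with i N.<? a | i′ N.<? a
  ... | yes i<a | yes i′<a = subst₂ _<_ (sym (place-left M j i<a)) (sym (place-left M j i′<a))
                               (NP.+-monoˡ-< ((M ∸ j) * a) (s≤s i<i′))
  ... | yes i<a | no  i′≮a = place-across M j j i<a (NP.≮⇒≥ i′≮a)
  ... | no  i≮a | yes i′<a = ⊥-elim (i≮a (NP.<-trans i<i′ i′<a))
  ... | no  i≮a | no  i′≮a = subst₂ _<_ (sym (place-right M j (NP.≮⇒≥ i≮a))) (sym (place-right M j (NP.≮⇒≥ i′≮a)))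
                               (NP.+-monoˡ-< (j * r) (NP.+-monoˡ-< (M * a) (s≤s i<i′)))
  before⇒place< M {j} {i} {j′} {i′} j≤M _ (outer-left i<a i′<a j′<j) = begin-strict
    place M j i                   ≡⟨ place-left M j i<a ⟩
    suc i + (M ∸ j) * a           ≤⟨ NP.+-monoˡ-≤ ((M ∸ j) * a) i<a ⟩
    suc (M ∸ j) * a               ≤⟨ NP.*-monoˡ-≤ a (NP.∸-monoʳ-< j′<j j≤M) ⟩
    (M ∸ j′) * a                  <⟨ NP.m<n+m _ z<s ⟩
    suc i′ + (M ∸ j′) * a         ≡⟨ sym (place-left M j′ i′<a) ⟩
    place M j′ i′                 ∎
    where open NP.≤-Reasoning
  before⇒place< M {j} {_} {j′} _ _ (across i<a a≤i′) = place-across M j j′ i<a a≤i′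
  before⇒place< M {j} {i} {j′} {i′} _ i<k (outer-right a≤i a≤i′ j<j′) = begin-strict
    place M j i                   ≡⟨ place-right M j a≤i ⟩
    suc i + M * a + j * r         ≡⟨ +-right-swap (suc i) (M * a) (j * r) ⟩
    suc i + j * r + M * a         <⟨ NP.+-monoˡ-< (M * a) right-step ⟩
    suc i′ + j′ * r + M * a       ≡⟨ +-right-swap (suc i′) (j′ * r) (M * a) ⟩
    suc i′ + M * a + j′ * r       ≡⟨ sym (place-right M j′ a≤i′) ⟩
    place M j′ i′                 ∎
    where
    open NP.≤-Reasoning
    right-step : suc i + j * r < suc i′ + j′ * r
    right-step = begin-strict
      suc i + j * r               ≤⟨ NP.+-monoˡ-≤ (j * r) i<k ⟩
      k + j * r                   ≡⟨ cong (_+ j * r) (sym a+r≡k) ⟩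
      a + r + j * r               ≡⟨ NP.+-assoc a r (j * r) ⟩
      a + suc j * r               ≤⟨ NP.+-mono-≤ a≤i′ (NP.*-monoˡ-≤ r j<j′) ⟩
      i′ + j′ * r                 <⟨ NP.n<1+n _ ⟩
      suc i′ + j′ * r             ∎

  distinct-edges : ∀ {j j′} i i′ → j < j′ → Before j i j′ i′ ⊎ Before j′ i′ j i
  distinct-edges i i′ j<j′ with i N.<? a | i′ N.<? a
  ... | yes i<a | yes i′<a = inj₂ (outer-left i′<a i<a j<j′)
  ... | yes i<a | no  i′≮a = inj₁ (across i<a (NP.≮⇒≥ i′≮a))
  ... | no  i≮a | yes i′<a = inj₂ (across i′<a (NP.≮⇒≥ i≮a))
  ... | no  i≮a | no  i′≮a = inj₁ (outer-right (NP.≮⇒≥ i≮a) (NP.≮⇒≥ i′≮a) j<j′)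

  compare : ∀ j i j′ i′ → (j ≡ j′ × i ≡ i′) ⊎ Before j i j′ i′ ⊎ Before j′ i′ j i
  compare j i j′ i′ with NP.<-cmp j j′
  ... | tri< j<j′ _ _ = inj₂ (distinct-edges i i′ j<j′)
  ... | tri> _ _ j′<j = inj₂ (swap (distinct-edges i′ i j′<j))
  ... | tri≈ _ refl _ with NP.<-cmp i i′
  ...   | tri< i<i′ _ _ = inj₂ (inj₁ (inner i<i′))
  ...   | tri≈ _ refl _ = inj₁ (refl , refl)
  ...   | tri> _ _ i′<i = inj₂ (inj₂ (inner i′<i))

  place<⇒before : ∀ M {j i j′ i′} → j ≤ M → j′ ≤ M → i < k → i′ < k →
                  place M j i < place M j′ i′ → Before j i j′ i′
  place<⇒before M {j} {i} {j′} {i′} j≤M j′≤M i<k i′<k lt with compare j i j′ i′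
  ... | inj₁ (refl , refl) = ⊥-elim (NP.<-irrefl refl lt)
  ... | inj₂ (inj₁ before) = before
  ... | inj₂ (inj₂ after)  = ⊥-elim (NP.<-asym lt (before⇒place< M j′≤M i′<k after))

  before-relabel : ∀ n (s : ℕ → ℕ) → (∀ {x y} → x < y → y ≤ n → s x < s y) →
                   ∀ {j i j′ i′} → j ≤ n → j′ ≤ n → Before j i j′ i′ → Before (s j) i (s j′) i′
  before-relabel n s mono _   _    (inner i<i′)                  = inner i<i′
  before-relabel n s mono j≤n _    (outer-left i<a i′<a j′<j)    = outer-left i<a i′<a (mono j′<j j≤n)
  before-relabel n s mono _   _    (across i<a a≤i′)             = across i<a a≤i′
  before-relabel n s mono _   j′≤n (outer-right a≤i a≤i′ j<j′)   = outer-right a≤i a≤i′ (mono j<j′ j′≤n)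

  left-outside : ∀ j {i} i′ → i < a → Before (suc j) i j i′
  left-outside j i′ i<a with i′ N.<? a
  ... | yes i′<a = outer-left i<a i′<a (NP.n<1+n j)
  ... | no  i′≮a = across i<a (NP.≮⇒≥ i′≮a)

  right-outside : ∀ j {i} i′ → a ≤ i → Before j i′ (suc j) i
  right-outside j i′ a≤i with i′ N.<? a
  ... | yes i′<a = across i′<a a≤i
  ... | no  i′≮a = outer-right (NP.≮⇒≥ i′≮a) a≤i (NP.n<1+n j)

  vertex<⇒place< : ∀ n {j i j′ i′} → j ≤ n → j′ ≤ n → vertex j i Z.< vertex j′ i′ → place n j i < place n j′ i′
  vertex<⇒place< n {j} {i} {j′} {i′} j≤n j′≤n lt = ZP.drop‿+<+
    (subst₂ Z._<_ (place-shift n j i j≤n) (place-shift n j′ i′ j′≤n) (ZP.+-monoˡ-< (+ (n * a)) lt))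

  place<⇒vertex< : ∀ n {j i j′ i′} → j ≤ n → j′ ≤ n → place n j i < place n j′ i′ → vertex j i Z.< vertex j′ i′
  place<⇒vertex< n {j} {i} {j′} {i′} j≤n j′≤n lt =
    subst₂ Z._<_ (ℤ-unshift (vertex j i) shift) (ℤ-unshift (vertex j′ i′) shift)
      (ZP.+-monoˡ-< (Z.- shift) (subst₂ Z._<_ (sym (place-shift n j i j≤n)) (sym (place-shift n j′ i′ j′≤n)) (Z.+<+ lt)))
    where shift = + (n * a)

  vertex-injective : ∀ n {j i j′ i′} → j ≤ n → j′ ≤ n → i < k → i′ < k →
                     vertex j i ≡ vertex j′ i′ → j ≡ j′ × i ≡ i′
  vertex-injective n {j} {i} {j′} {i′} j≤n j′≤n i<k i′<k eq = from-compare (compare j i j′ i′)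
    where
    same-place : place n j i ≡ place n j′ i′
    same-place = ZP.+-injective (trans (sym (place-shift n j i j≤n))
                   (trans (cong (Z._+ + (n * a)) eq) (place-shift n j′ i′ j′≤n)))
    from-compare : (j ≡ j′ × i ≡ i′) ⊎ Before j i j′ i′ ⊎ Before j′ i′ j i → j ≡ j′ × i ≡ i′
    from-compare (inj₁ same)          = same
    from-compare (inj₂ (inj₁ before)) = ⊥-elim (NP.<-irrefl same-place (before⇒place< n j≤n i<k before))
    from-compare (inj₂ (inj₂ after))  = ⊥-elim (NP.<-irrefl (sym same-place) (before⇒place< n j′≤n i′<k after))

  edge∈ : ∀ n j → j ≤ n → edge j LM.∈ edgesUpTo n
  edge∈ zero    zero    _    = LA.here refl
  edge∈ (suc n) j       j≤sn with NP.m≤n⇒m<n∨m≡n j≤sn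
  ... | inj₁ j<sn = LMP.∈-++⁺ˡ (edge∈ n j (NP.≤-pred j<sn))
  ... | inj₂ refl = LMP.∈-++⁺ʳ (edgesUpTo n) (LA.here refl)

  ∈edgesUpTo : ∀ n {A} → A LM.∈ edgesUpTo n → Σ ℕ λ j → j ≤ n × A ≡ edge j
  ∈edgesUpTo zero    (LA.here eq) = 0 , z≤n , eq
  ∈edgesUpTo (suc n) A∈ with LMP.∈-++⁻ (edgesUpTo n) A∈
  ... | inj₁ A∈n with ∈edgesUpTo n A∈n
  ...   | j , j≤n , eq = j , NP.m≤n⇒m≤1+n j≤n , eq
  ∈edgesUpTo (suc n) A∈ | inj₂ (LA.here eq) = suc n , NP.≤-refl , eq

  vertex∈V : ∀ n j i → j ≤ n → i < k → vertex j i ∈V edgesUpTo n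
  vertex∈V n j i j≤n i<k = LM.lose (edge∈ n j j≤n)
    (subst (VM._∈ edge j) (trans (lookup-edge j (fromℕ< i<k)) (cong (vertex j) (FP.toℕ-fromℕ< i<k)))
      (VMP.∈-lookup (fromℕ< i<k) (edge j)))

  ∈V⇒vertex : ∀ n {x} → x ∈V edgesUpTo n → Σ ℕ λ j → Σ ℕ λ i → j ≤ n × i < k × x ≡ vertex j i
  ∈V⇒vertex n x∈ with LM.find x∈
  ... | A , A∈ , x∈A with ∈edgesUpTo n A∈
  ...   | j , j≤n , refl = j , toℕ i , j≤n , FP.toℕ<n i , trans (VAP.lookup-index x∈A) (lookup-edge j i)
    where i = VA.index x∈A

colour-transport : ∀ {k N t} (c : Colouring k N t) {u v} (eq : u ≡ v) (E : IsEdge k N u) →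
                   c v (subst (IsEdge k N) eq E) ≡ c u E
colour-transport c refl E = refl

module Upper (k t r : ℕ) (r≤k : r ≤ k) (e : Fin t → ℕ) where
  open Nested k r r≤k

  h : Fin t → ℕ
  h i = e i ∸ 1

  S : ℕ
  S = sumFin t h

  N : ℕ
  N = k * (1 + S)

  private
    a≤k : a ≤ k
    a≤k = NP.m∸n≤m k r

    k+Sk≡N : k + S * k ≡ N
    k+Sk≡N = trans (cong (_+_ k) (NP.*-comm S k)) (sym (NP.*-suc k S))

  place-range : ∀ J i → J ≤ S → i < k → 1 ≤ place S J i × place S J i ≤ N
  place-range J i J≤S i<k with i N.<? a
  ... | yes i<a = subst (1 ≤_) (sym (place-left S J i<a)) (s≤s z≤n) , (begin
    place S J i                 ≡⟨ place-left S J i<a ⟩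
    suc i + (S ∸ J) * a         ≤⟨ NP.+-mono-≤ i<a (NP.*-monoˡ-≤ a (NP.m∸n≤m S J)) ⟩
    a + S * a                   ≤⟨ NP.+-mono-≤ a≤k (NP.*-monoʳ-≤ S a≤k) ⟩
    k + S * k                   ≡⟨ k+Sk≡N ⟩
    N                           ∎)
    where open NP.≤-Reasoning
  ... | no  i≮a = subst (1 ≤_) (sym (place-right S J a≤i)) (s≤s z≤n) , (begin
    place S J i                 ≡⟨ place-right S J a≤i ⟩
    suc i + S * a + J * r       ≤⟨ NP.+-mono-≤ (NP.+-monoˡ-≤ (S * a) i<k) (NP.*-monoˡ-≤ r J≤S) ⟩
    k + S * a + S * r           ≡⟨ NP.+-assoc k (S * a) (S * r) ⟩
    k + (S * a + S * r)         ≡⟨ cong (_+_ k) (sym (NP.*-distribˡ-+ S a r)) ⟩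
    k + S * (a + r)             ≡⟨ cong (λ m → k + S * m) a+r≡k ⟩
    k + S * k                   ≡⟨ k+Sk≡N ⟩
    N                           ∎)
    where
    open NP.≤-Reasoning
    a≤i = NP.≮⇒≥ i≮a

  slot : ℕ → Vec ℕ k
  slot J = tabulate (place S J ∘ toℕ)

  slot-edge : ∀ J → J ≤ S → IsEdge k N (slot J)
  slot-edge J J≤S =
    (λ i i′ i<i′ → subst₂ _<_ (sym (VP.lookup∘tabulate _ i)) (sym (VP.lookup∘tabulate _ i′))
        (before⇒place< S J≤S (FP.toℕ<n i) (inner i<i′))) ,
    (λ i → subst (λ m → 1 ≤ m × m ≤ N) (sym (VP.lookup∘tabulate _ i)) (place-range J (toℕ i) J≤S (FP.toℕ<n i)))

  -- The colouring c read on slots (slots beyond S are identified with slot S).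
  slotColour : Colouring k N t → ℕ → Fin t
  slotColour c J = c (slot (J ⊓ S)) (slot-edge (J ⊓ S) (NP.m⊓n≤n J S))

  -- Slots s 0 < … < s n ≤ S all of colour i carry a copy of M_{n+1} in colour i:
  -- vertex (j, i′) goes to place S (s j) i′.
  copy : (c : Colouring k N t) (i : Fin t) (n : ℕ) (s : ℕ → ℕ) →
         (∀ l → l < n → s l < s (suc l)) → (∀ l → l ≤ n → s l ≤ S) →
         (∀ l → l ≤ n → slotColour c (s l) ≡ i) → Contains c i (edgesUpTo n)
  copy c i n s step s≤S monochromatic = f , f-order , f-range , f-edges
    where
    labels : List (ℕ × ℕ)
    labels = cartesianProduct (upTo (suc n)) (upTo k)

    image : ℕ × ℕ → ℕ
    image (j , i′) = place S (s j) i′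

    f : ℤ → ℕ
    f = tableOn ZP._≟_ (uncurry vertex) image 0 labels

    -- f sends vertex (j, i′) to its intended place, since labels name vertices uniquely.
    f-vertex : ∀ {j i′} → j ≤ n → i′ < k → f (vertex j i′) ≡ place S (s j) i′
    f-vertex {j} {i′} j≤n i′<k =
      tableOn-key ZP._≟_ (uncurry vertex) image 0 labels
        (LMP.∈-cartesianProduct⁺ (LMP.∈-upTo⁺ (s≤s j≤n)) (LMP.∈-upTo⁺ i′<k)) functional
      where
      functional : ∀ {x} → x LM.∈ labels → uncurry vertex x ≡ vertex j i′ → image x ≡ image (j , i′)
      functional {j₁ , i₁} x∈ eq with LMP.∈-cartesianProduct⁻ (upTo (suc n)) (upTo k) x∈
      ... | j₁∈ , i₁∈ with vertex-injective n (NP.≤-pred (LMP.∈-upTo⁻ j₁∈)) j≤n (LMP.∈-upTo⁻ i₁∈) i′<k eq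
      ...   | refl , refl = refl

    s-mono : ∀ {x y} → x < y → y ≤ n → s x < s y
    s-mono = step-mono s n step

    -- vertex order = Before, preserved by relabelling, = placement order in M_{S+1}
    f-order : ∀ x y → x ∈V edgesUpTo n → y ∈V edgesUpTo n → x Z.< y → f x < f y
    f-order x y x∈ y∈ x<y with ∈V⇒vertex n x∈ | ∈V⇒vertex n y∈
    ... | j , i₁ , j≤n , i₁<k , refl | j′ , i₂ , j′≤n , i₂<k , refl =
      subst₂ _<_ (sym (f-vertex j≤n i₁<k)) (sym (f-vertex j′≤n i₂<k))
        (before⇒place< S (s≤S j j≤n) i₁<k
          (before-relabel n s s-mono j≤n j′≤n
            (place<⇒before n j≤n j′≤n i₁<k i₂<k (vertex<⇒place< n j≤n j′≤n x<y))))

    f-range : ∀ x → x ∈V edgesUpTo n → 1 ≤ f x × f x ≤ N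
    f-range x x∈ with ∈V⇒vertex n x∈
    ... | j , i′ , j≤n , i′<k , refl =
      subst (λ m → 1 ≤ m × m ≤ N) (sym (f-vertex j≤n i′<k)) (place-range (s j) i′ (s≤S j j≤n) i′<k)

    image-edge : ∀ {j} → j ≤ n → slot (s j ⊓ S) ≡ V.map f (edge j)
    image-edge {j} j≤n = begin
      slot (s j ⊓ S)                         ≡⟨ cong slot (NP.m≤n⇒m⊓n≡m (s≤S j j≤n)) ⟩
      tabulate (place S (s j) ∘ toℕ)         ≡⟨ VP.tabulate-cong (λ i′ → sym (f-vertex j≤n (FP.toℕ<n i′))) ⟩
      tabulate (f ∘ vertex j ∘ toℕ)          ≡⟨ VP.tabulate-∘ f (vertex j ∘ toℕ) ⟩
      V.map f (edge j)                       ∎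
      where open ≡-Reasoning

    f-edges : ∀ A → A LM.∈ edgesUpTo n → Σ (IsEdge k N (V.map f A)) λ E → c (V.map f A) E ≡ i
    f-edges A A∈ with ∈edgesUpTo n A∈
    ... | j , j≤n , refl =
      subst (IsEdge k N) (image-edge j≤n) slot-E ,
      trans (colour-transport c (image-edge j≤n) slot-E) (monochromatic j j≤n)
      where slot-E = slot-edge (s j ⊓ S) (NP.m⊓n≤n (s j) S)

  -- Colour the slots by c and take a pigeonhole class for the demands h.
  upper : RamseyProp k t (λ i → M (e i) k r) N
  upper c = colour , subst (Contains c colour) (sym (M-explicit (e colour)))
    (copy c colour (h colour) pick pick-step (λ l l≤ → NP.≤-pred (proj₂ (pick-range l l≤))) pick-colour)
    where open Class (pigeonhole (slotColour c) h 0 (suc S) NP.≤-refl)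

module Lower (k t r : ℕ) (r≤k : r ≤ k) (e : Fin (suc t) → ℕ) (N : ℕ)
             (N<bound : N < k * (1 + sumFin (suc t) (λ i → e i ∸ 1))) where
  open Nested k r r≤k
  open Gap k N a r a+r≡k

  h : Fin (suc t) → ℕ
  h i = e i ∸ 1

  w : Fin (suc t) → ℕ
  w i = k * h i

  gapColouring : Colouring k N (suc t)
  gapColouring v _ = blockOf t w (gap v)

  gap≤Σw : ∀ {v} → IsEdge k N v → gap v ≤ sumFin (suc t) w
  gap≤Σw {v} E = NP.+-cancelˡ-≤ k (gap v) _ (begin
    k + gap v                       ≡⟨ NP.+-comm k (gap v) ⟩
    gap v + k                       ≤⟨ gap-bound E ⟩
    suc N                           ≤⟨ N<bound ⟩
    k * (1 + sumFin (suc t) h)      ≡⟨ NP.*-suc k _ ⟩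
    k + k * sumFin (suc t) h        ≡⟨ cong (_+_ k) (sym (sumFin-*ˡ (suc t) k h)) ⟩
    k + sumFin (suc t) w            ∎)
    where open NP.≤-Reasoning

  -- No colour i contains M_{e_i}: compare the first and the last gap of a copy.
  no-copy : ∀ i → Contains gapColouring i (edgesUpTo (h i)) → ⊥
  no-copy i (f , f-order , _ , f-edges) = NP.<-irrefl refl impossible
    where
    n = h i

    u : ℕ → Vec ℕ k
    u j = V.map f (edge j)

    u-edge : ∀ {j} → j ≤ n → IsEdge k N (u j)
    u-edge {j} j≤n = proj₁ (f-edges (edge j) (edge∈ n j j≤n))

    u-colour : ∀ {j} → j ≤ n → blockOf t w (gap (u j)) ≡ i
    u-colour {j} j≤n = proj₂ (f-edges (edge j) (edge∈ n j j≤n))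

    lookup-u : ∀ j (i′ : Fin k) → lookup (u j) i′ ≡ f (vertex j (toℕ i′))
    lookup-u j i′ = trans (VP.lookup-map i′ f (edge j)) (cong f (lookup-edge j i′))

    f-before : ∀ {j₁ j₂} (i₁ i₂ : Fin k) → j₁ ≤ n → j₂ ≤ n → Before j₁ (toℕ i₁) j₂ (toℕ i₂) →
               lookup (u j₁) i₁ < lookup (u j₂) i₂
    f-before {j₁} {j₂} i₁ i₂ j₁≤n j₂≤n before =
      subst₂ _<_ (sym (lookup-u j₁ i₁)) (sym (lookup-u j₂ i₂))
        (f-order _ _ (vertex∈V n j₁ (toℕ i₁) j₁≤n (FP.toℕ<n i₁)) (vertex∈V n j₂ (toℕ i₂) j₂≤n (FP.toℕ<n i₂))
          (place<⇒vertex< n j₁≤n j₂≤n (before⇒place< n j₁≤n (FP.toℕ<n i₁) before)))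

    enclosing : ∀ j → suc j ≤ n → Encloses a (u (suc j)) (u j)
    enclosing j sj≤n i′ i″ =
      (λ i′<a → f-before i′ i″ sj≤n j≤n (left-outside j (toℕ i″) i′<a)) ,
      (λ a≤i′ → f-before i″ i′ j≤n sj≤n (right-outside j (toℕ i″) a≤i′))
      where j≤n = NP.<⇒≤ sj≤n

    gap-growth : ∀ j → j ≤ n → gap (u 0) + j * k ≤ gap (u j)
    gap-growth zero    _    = NP.≤-reflexive (NP.+-identityʳ _)
    gap-growth (suc j) sj≤n = begin
      gap (u 0) + (k + j * k)       ≡⟨ +-assoc-swap (gap (u 0)) k (j * k) ⟩
      gap (u 0) + j * k + k         ≤⟨ NP.+-monoˡ-≤ k (gap-growth j (NP.<⇒≤ sj≤n)) ⟩
      gap (u j) + k                 ≤⟨ gap-nested (u-edge (NP.<⇒≤ sj≤n)) (enclosing j sj≤n) ⟩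
      gap (u (suc j))               ∎
      where open NP.≤-Reasoning

    first-gap : offset w i < gap (u 0)
    first-gap = subst (λ b → offset w b < gap (u 0)) (u-colour z≤n)
                  (blockOf-lower t w _ (gap-positive (u-edge z≤n)))

    last-gap : gap (u n) ≤ offset w i + w i
    last-gap = subst (λ b → gap (u n) ≤ offset w b + w b) (u-colour NP.≤-refl)
                 (blockOf-upper t w _ (gap≤Σw (u-edge NP.≤-refl)))

    impossible : offset w i + w i < offset w i + w i
    impossible = begin-strict
      offset w i + k * n      ≡⟨ cong (_+_ (offset w i)) (NP.*-comm k n) ⟩
      offset w i + n * k      <⟨ NP.+-monoˡ-< (n * k) first-gap ⟩
      gap (u 0) + n * k       ≤⟨ gap-growth n NP.≤-refl ⟩
      gap (u n)               ≤⟨ last-gap ⟩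
      offset w i + k * n      ∎
      where open NP.≤-Reasoning

  lower : RamseyProp k (suc t) (λ i → M (e i) k r) N → ⊥
  lower ramsey with ramsey gapColouring
  ... | i , contains = no-copy i (subst (Contains gapColouring i) (M-explicit (e i)) contains)

-- Below the claimed value no N has the Ramsey property (for t = 0, K_N^k has no edges).
no-ramsey : ∀ k t r → r ≤ k → (e : Fin t → ℕ) →
            ∀ N → N < k * (1 + sumFin t (λ i → e i ∸ 1)) → RamseyProp k t (λ i → M (e i) k r) N → ⊥
no-ramsey k zero    r _   e N N<k ramsey with ramsey (λ v E → ⊥-elim (NP.<⇒≱ N<k′ (edge-size {v = v} E)))
  where N<k′ = subst (N <_) (NP.*-identityʳ k) N<k
... | () , _
no-ramsey k (suc t) r r≤k e N N<bound = Lower.lower k t r r≤k e N N<bound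

theorem10 : (k t r : ℕ) → 1 ≤ k → r ≤ k →
    (e : Fin t → ℕ) → (∀ i → 1 ≤ e i) →
    RamseyNumberIs k t (λ i → M (e i) k r) (k * (1 + sumFin t (λ i → e i ∸ 1)))
theorem10 k t r _ r≤k e _ = Upper.upper k t r r≤k e , no-ramsey k t r r≤k e
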